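{- If $n$ and $m$ are distinct perfect numbers and $\delta := |n-m|$, then $\delta \nmid n$.
   Context: A positive integer $N$ is perfect if $\sigma(N) = 2N$, where $\sigma$ denotes the sum-of-divisors function. -}

module Defs where

open import Data.Nat using (ℕ; suc; _+_; _*_; _>_)
open import Data.Nat.Divisibility using (_∣_; _∣?_)
open import Data.List using (List; filter; upTo; map)
open import Data.Nat.ListAction using (sum)
open import Data.Product using (_×_)
open import Relation.Binary.PropositionalEquality using (_≡_)

σ : ℕ → ℕ
σ N = sum (filter (_∣? N) (map suc (upTo N)))

Perfect : ℕ → Set
Perfect N = (N > 0) × (σ N ≡ 2 * N)

module Submission where

-- Call the smaller number x and the larger x + d.  Since d divides one of
-- them it divides both, so it suffices to refute: x and x + d perfect with
-- 0 < d ∣ x (no-perfect-gap).  We split on the parities of x and x + d.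
--  * Both odd: d ∣ x is odd, so x + d is even.
--  * Both even: by Euler every even perfect number is 2^k (2^(k+1) − 1) with
--    a Mersenne prime factor, and the next one exceeds twice the previous,
--    whereas x < x + d ≤ 2x.
--  * Mixed: E = 2^k g even, O odd, and d ∣ g forces d ∈ {1, g}.  For k = 1
--    (E = 6) the possible O are checked directly; for k ≥ 2 we have
--    E ≡ d ≡ 1 (mod 3) and 4 ∣ E, so O ≡ 2 (mod 3), O ≡ 3 (mod 4), or
--    O = (2^k − 1) g; a perfect number is never ≡ 2 (mod 3) nor ≡ 3 (mod 4)
--    (its divisors pair up as e + N/e ≡ 0), and σ((2^k − 1) g) is computed.

open import Defs
open import Data.Nat
open import Data.Nat.Properties
open import Data.Nat.Induction using (<-rec)
open import Data.Nat.DivMod using (m*[n/m]≡n; m%n<n; %-distribˡ-*; %-distribˡ-+; [m+kn]%n≡m%n; %-pred-≡0)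
open import Data.Nat.Tactic.RingSolver using (solve-∀)
open import Data.Nat.Divisibility
open import Data.Nat.Primality using (Prime; Irreducible; prime⇒irreducible; irreducible⇒prime; prime⇒nonZero; prime[2]; euclidsLemma)
open import Data.Nat.Coprimality using (Coprime; coprime-divisor)
open import Data.Nat.ListAction using (sum)
open import Data.Nat.ListAction.Properties using (sum-↭; sum-++)
open import Data.List using (List; []; _∷_; filter; upTo; map; _++_)
open import Data.List.Membership.Propositional using (_∈_; _∉_)
open import Data.List.Membership.Propositional.Properties
open import Data.List.Membership.Propositional.Properties.WithK using (unique∧set⇒bag)
open import Data.List.Membership.DecPropositional _≟_ using (_∈?_; _∉?_)
open import Data.List.Relation.Binary.BagAndSetEquality using (∼bag⇒↭)
open import Data.List.Relation.Unary.Unique.Propositional using (Unique)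
import Data.List.Relation.Unary.Unique.Propositional.Properties as Unique
open import Data.List.Relation.Unary.All using ([]; _∷_)
import Data.List.Relation.Unary.All as All
open import Data.List.Relation.Unary.AllPairs using ([]; _∷_)
open import Data.List.Relation.Unary.Any using (here; there)
open import Data.Product using (∃; _×_; _,_; proj₁; proj₂)
open import Data.Sum using (_⊎_; inj₁; inj₂; [_,_]′)
open import Data.Empty using (⊥; ⊥-elim)
open import Function.Bundles using (mk⇔)
open import Relation.Nullary using (¬_; Dec; yes; no; ¬?; contradiction)
open import Relation.Nullary.Decidable using (decidable-stable; toWitness; _→-dec_)
open import Data.Unit using (tt)
open import Relation.Binary.PropositionalEquality
open import Relation.Binary.Definitions using (tri<; tri≈; tri>)

divisors : ℕ → List ℕ
divisors N = filter (_∣? N) (map suc (upTo N))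

divisors-unique : ∀ N → Unique (divisors N)
divisors-unique N = Unique.filter⁺ (_∣? N) (Unique.map⁺ suc-injective (Unique.upTo⁺ N))

∈-divisors⁻ : ∀ {N x} → x ∈ divisors N → x ∣ N × x > 0
∈-divisors⁻ {N} x∈ with ∈-filter⁻ (_∣? N) {xs = map suc (upTo N)} x∈
... | x∈suc , x∣N with ∈-map⁻ suc {xs = upTo N} x∈suc
... | _ , _ , refl = x∣N , z<s

∈-divisors⁺ : ∀ {N x} → N > 0 → x ∣ N → x ∈ divisors N
∈-divisors⁺ {suc N} {zero} _ 0∣N with () ← 0∣⇒≡0 0∣N
∈-divisors⁺ {suc N} {suc x} _ x∣N =
  ∈-filter⁺ (_∣? suc N) (∈-map⁺ suc (∈-upTo⁺ (∣⇒≤ x∣N))) x∣N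

sum-cong-∈ : {xs ys : List ℕ} → Unique xs → Unique ys →
  (∀ {x} → x ∈ xs → x ∈ ys) → (∀ {x} → x ∈ ys → x ∈ xs) → sum xs ≡ sum ys
sum-cong-∈ uxs uys to from = sum-↭ (∼bag⇒↭ (unique∧set⇒bag uxs uys (mk⇔ to from)))

sum-mono-⊆ : {xs ys : List ℕ} → Unique xs → Unique ys →
  (∀ {x} → x ∈ xs → x ∈ ys) → sum xs ≤ sum ys
sum-mono-⊆ {xs} {ys} uxs uys xs⊆ys = begin
    sum xs              ≤⟨ m≤m+n (sum xs) _ ⟩
    sum xs + sum rest   ≡⟨ sum-++ xs rest ⟨
    sum (xs ++ rest)    ≡⟨ sum-cong-∈ (Unique.++⁺ uxs (Unique.filter⁺ (_∉? xs) uys) disjoint) uys to from ⟩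
    sum ys              ∎
  where
  open ≤-Reasoning
  rest : List ℕ
  rest = filter (_∉? xs) ys
  disjoint : ∀ {v} → ¬ (v ∈ xs × v ∈ rest)
  disjoint (v∈xs , v∈rest) = proj₂ (∈-filter⁻ (_∉? xs) {xs = ys} v∈rest) v∈xs
  to : ∀ {x} → x ∈ xs ++ rest → x ∈ ys
  to x∈ with ∈-++⁻ xs x∈
  ... | inj₁ x∈xs   = xs⊆ys x∈xs
  ... | inj₂ x∈rest = proj₁ (∈-filter⁻ (_∉? xs) {xs = ys} x∈rest)
  from : ∀ {x} → x ∈ ys → x ∈ xs ++ rest
  from {x} x∈ys with x ∉? xs
  ... | yes x∉xs = ∈-++⁺ʳ xs (∈-filter⁺ (_∉? xs) x∈ys x∉xs)
  ... | no ¬x∉xs = ∈-++⁺ˡ (decidable-stable (x ∈? xs) ¬x∉xs)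

sum≤σ : ∀ {N} {ds : List ℕ} → N > 0 → Unique ds → (∀ {x} → x ∈ ds → x ∣ N) → sum ds ≤ σ N
sum≤σ {N} N>0 uds ds∣N = sum-mono-⊆ uds (divisors-unique N) (λ x∈ → ∈-divisors⁺ N>0 (ds∣N x∈))

n≤σn : ∀ {N} → N > 0 → N ≤ σ N
n≤σn {N} N>0 = subst (_≤ σ N) (+-identityʳ N) (sum≤σ N>0 ([] ∷ []) N∣N)
  where
  N∣N : ∀ {x} → x ∈ N ∷ [] → x ∣ N
  N∣N (here refl) = ∣-refl

σ-nontrivial-divisor : ∀ {N d} → 1 < d → d < N → d ∣ N → 1 + d + N ≤ σ N
σ-nontrivial-divisor {N} {d} 1<d d<N d∣N = subst (_≤ σ N) (cong (λ k → suc (d + k)) (+-identityʳ N))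
  (sum≤σ (<-trans z<s (<-trans 1<d d<N)) distinct all∣N)
  where
  distinct : Unique (1 ∷ d ∷ N ∷ [])
  distinct = ((<⇒≢ 1<d) ∷ (<⇒≢ (<-trans 1<d d<N)) ∷ []) ∷ ((<⇒≢ d<N) ∷ []) ∷ [] ∷ []
  all∣N : ∀ {x} → x ∈ 1 ∷ d ∷ N ∷ [] → x ∣ N
  all∣N (here refl) = 1∣ N
  all∣N (there (here refl)) = d∣N
  all∣N (there (there (here refl))) = ∣-refl

σ≡suc⇒prime : ∀ {N} → 1 < N → σ N ≡ N + 1 → Prime N
σ≡suc⇒prime {N} 1<N σN≡N+1 = irreducible⇒prime {{n>1⇒nonTrivial 1<N}} irreducible
  where
  irreducible : Irreducible N
  irreducible {d} d∣N with d ≟ 1 | d ≟ N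
  ... | yes d≡1 | _ = inj₁ d≡1
  ... | no _ | yes d≡N = inj₂ d≡N
  ... | no d≢1 | no d≢N = ⊥-elim (<⇒≱ N+1<σN (≤-reflexive σN≡N+1))
    where
    N>0 : N > 0
    N>0 = <-trans z<s 1<N
    d>0 : d > 0
    d>0 = n≢0⇒n>0 (λ { refl → <⇒≢ N>0 (sym (0∣⇒≡0 d∣N)) })
    1<d : 1 < d
    1<d = ≤∧≢⇒< d>0 (λ 1≡d → d≢1 (sym 1≡d))
    d<N : d < N
    d<N = ≤∧≢⇒< (∣⇒≤ {{>-nonZero N>0}} d∣N) d≢N
    N+1<σN : N + 1 < σ N
    N+1<σN = begin-strict
      N + 1      ≡⟨ +-comm N 1 ⟩
      1 + N      <⟨ +-monoˡ-< N (+-monoʳ-< 1 d>0) ⟩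
      1 + d + N  ≤⟨ σ-nontrivial-divisor 1<d d<N d∣N ⟩
      σ N        ∎
      where open ≤-Reasoning

prime∤⇒coprime : ∀ {p x} → Prime p → p ∤ x → Coprime x p
prime∤⇒coprime pp p∤x (d∣x , d∣p) with prime⇒irreducible pp d∣p
... | inj₁ d≡1 = d≡1
... | inj₂ refl = contradiction d∣x p∤x

coprime-∣-pow* : ∀ {x p c} j → Coprime x p → x ∣ p ^ j * c → x ∣ c
coprime-∣-pow* {x} {p} {c} zero    _   x∣ = subst (x ∣_) (+-identityʳ c) x∣
coprime-∣-pow* {x} {p} {c} (suc j) x⊥p x∣ =
  coprime-∣-pow* j x⊥p (coprime-divisor x⊥p (subst (x ∣_) (*-assoc p (p ^ j) c) x∣))

sum-map-* : ∀ p xs → sum (map (p *_) xs) ≡ p * sum xs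
sum-map-* p []       = sym (*-zeroʳ p)
sum-map-* p (x ∷ xs) = trans (cong (p * x +_) (sum-map-* p xs)) (sym (*-distribˡ-+ p x (sum xs)))

_∤?_ : (p x : ℕ) → Dec (p ∤ x)
p ∤? x = ¬? (p ∣? x)

σ∤ : ℕ → ℕ → ℕ
σ∤ p N = sum (filter (p ∤?_) (divisors N))

-- For prime p, a divisor of p N is either a divisor of N prime to p, or p times
-- a divisor of N (and not both); summing gives the recursion below.
σ-prime-split : ∀ {p N} → Prime p → N > 0 → σ (p * N) ≡ σ∤ p N + p * σ N
σ-prime-split {p} {N} pp N>0 = begin
    σ (p * N)                 ≡⟨ sum-cong-∈ (divisors-unique (p * N)) unique-split to from ⟩
    sum (coprimePart ++ pPart) ≡⟨ sum-++ coprimePart pPart ⟩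
    σ∤ p N + sum pPart        ≡⟨ cong (σ∤ p N +_) (sum-map-* p (divisors N)) ⟩
    σ∤ p N + p * σ N          ∎
  where
  open ≡-Reasoning
  instance p≢0 : NonZero p
  p≢0 = prime⇒nonZero pp
  coprimePart pPart : List ℕ
  coprimePart = filter (p ∤?_) (divisors N)
  pPart = map (p *_) (divisors N)
  pN>0 : p * N > 0
  pN>0 = *-mono-≤ (>-nonZero⁻¹ p) N>0
  disjoint : ∀ {v} → ¬ (v ∈ coprimePart × v ∈ pPart)
  disjoint (v∈coprime , v∈p) with ∈-map⁻ (p *_) {xs = divisors N} v∈p
  ... | q , _ , refl = proj₂ (∈-filter⁻ (p ∤?_) {xs = divisors N} v∈coprime) (m∣m*n q)
  unique-split : Unique (coprimePart ++ pPart)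
  unique-split = Unique.++⁺ (Unique.filter⁺ (p ∤?_) (divisors-unique N))
                            (Unique.map⁺ (*-cancelˡ-≡ _ _ p) (divisors-unique N)) disjoint
  to : ∀ {x} → x ∈ divisors (p * N) → x ∈ coprimePart ++ pPart
  to {x} x∈ with proj₁ (∈-divisors⁻ {p * N} x∈) | p ∣? x
  ... | x∣pN | yes (divides q refl) = ∈-++⁺ʳ coprimePart (subst (_∈ pPart) (*-comm p q)
          (∈-map⁺ (p *_) (∈-divisors⁺ N>0 (*-cancelˡ-∣ p (subst (_∣ p * N) (*-comm q p) x∣pN)))))
  ... | x∣pN | no p∤x = ∈-++⁺ˡ (∈-filter⁺ (p ∤?_)
          (∈-divisors⁺ N>0 (coprime-divisor (prime∤⇒coprime pp p∤x) x∣pN)) p∤x)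
  from : ∀ {x} → x ∈ coprimePart ++ pPart → x ∈ divisors (p * N)
  from x∈ with ∈-++⁻ coprimePart x∈
  ... | inj₁ x∈coprime = ∈-divisors⁺ pN>0 (∣-trans
          (proj₁ (∈-divisors⁻ (proj₁ (∈-filter⁻ (p ∤?_) {xs = divisors N} x∈coprime)))) (n∣m*n p))
  ... | inj₂ x∈p with ∈-map⁻ (p *_) {xs = divisors N} x∈p
  ... | q , q∈ , refl = ∈-divisors⁺ pN>0 (*-monoʳ-∣ p (proj₁ (∈-divisors⁻ q∈)))

σ∤-prime-power : ∀ {p c} j → Prime p → p ∤ c → c > 0 → σ∤ p (p ^ j * c) ≡ σ c
σ∤-prime-power {p} {c} j pp p∤c c>0 =
  sum-cong-∈ (Unique.filter⁺ (p ∤?_) (divisors-unique (p ^ j * c))) (divisors-unique c) to from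
  where
  instance p≢0 : NonZero p
  p≢0 = prime⇒nonZero pp
  to : ∀ {x} → x ∈ filter (p ∤?_) (divisors (p ^ j * c)) → x ∈ divisors c
  to x∈ with ∈-filter⁻ (p ∤?_) {xs = divisors (p ^ j * c)} x∈
  ... | x∈divs , p∤x = ∈-divisors⁺ c>0
          (coprime-∣-pow* j (prime∤⇒coprime pp p∤x) (proj₁ (∈-divisors⁻ x∈divs)))
  from : ∀ {x} → x ∈ divisors c → x ∈ filter (p ∤?_) (divisors (p ^ j * c))
  from {x} x∈ = ∈-filter⁺ (p ∤?_)
    (∈-divisors⁺ (*-mono-≤ (m^n>0 p j) c>0) (∣-trans x∣c (n∣m*n (p ^ j))))
    (λ p∣x → p∤c (∣-trans p∣x x∣c))
    where
    x∣c : x ∣ c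
    x∣c = proj₁ (∈-divisors⁻ x∈)

geom : ℕ → ℕ → ℕ
geom p zero    = 1
geom p (suc j) = 1 + p * geom p j

geom>0 : ∀ p j → geom p j > 0
geom>0 p zero    = z<s
geom>0 p (suc j) = z<s

σ-prime-power : ∀ {p c} j → Prime p → p ∤ c → c > 0 → σ (p ^ j * c) ≡ geom p j * σ c
σ-prime-power {p} {c} zero pp p∤c c>0 = trans (cong σ (+-identityʳ c)) (sym (+-identityʳ (σ c)))
σ-prime-power {p} {c} (suc j) pp p∤c c>0 = begin
    σ (p * p ^ j * c)                     ≡⟨ cong σ (*-assoc p (p ^ j) c) ⟩
    σ (p * (p ^ j * c))                   ≡⟨ σ-prime-split pp (*-mono-≤ (m^n>0 p j) c>0) ⟩
    σ∤ p (p ^ j * c) + p * σ (p ^ j * c)  ≡⟨ cong₂ _+_ (σ∤-prime-power j pp p∤c c>0)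
                                                     (cong (p *_) (σ-prime-power j pp p∤c c>0)) ⟩
    σ c + p * (geom p j * σ c)            ≡⟨ cong (σ c +_) (sym (*-assoc p (geom p j) (σ c))) ⟩
    σ c + p * geom p j * σ c              ∎
  where
  open ≡-Reasoning
  instance p≢0 : NonZero p
  p≢0 = prime⇒nonZero pp

geom2+1 : ∀ j → geom 2 j + 1 ≡ 2 ^ suc j
geom2+1 zero    = refl
geom2+1 (suc j) = begin
    1 + 2 * geom 2 j + 1  ≡⟨ +-comm (1 + 2 * geom 2 j) 1 ⟩
    2 + 2 * geom 2 j      ≡⟨ *-distribˡ-+ 2 1 (geom 2 j) ⟨
    2 * (1 + geom 2 j)    ≡⟨ cong (2 *_) (+-comm 1 (geom 2 j)) ⟩
    2 * (geom 2 j + 1)    ≡⟨ cong (2 *_) (geom2+1 j) ⟩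
    2 * 2 ^ suc j         ∎
  where open ≡-Reasoning

TwoAdic : ℕ → Set
TwoAdic N = ∃ λ k → ∃ λ c → N ≡ 2 ^ k * c × 2 ∤ c

two-adic : ∀ N → N > 0 → TwoAdic N
two-adic = <-rec (λ N → N > 0 → TwoAdic N) step
  where
  step : ∀ N → (∀ {q} → q < N → q > 0 → TwoAdic q) → N > 0 → TwoAdic N
  step N rec N>0 with 2 ∣? N
  ... | no 2∤N = 0 , N , sym (+-identityʳ N) , 2∤N
  ... | yes (divides zero refl) = contradiction N>0 (<-irrefl refl)
  ... | yes (divides q@(suc _) refl) with rec (m<m*n q 2 (s≤s (s≤s z≤n))) z<s
  ...   | k , c , q≡2^kc , 2∤c = suc k , c , q*2≡2^[1+k]c , 2∤c
    where
    q*2≡2^[1+k]c : q * 2 ≡ 2 * 2 ^ k * c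
    q*2≡2^[1+k]c = begin
      q * 2            ≡⟨ cong (_* 2) q≡2^kc ⟩
      2 ^ k * c * 2    ≡⟨ *-comm (2 ^ k * c) 2 ⟩
      2 * (2 ^ k * c)  ≡⟨ *-assoc 2 (2 ^ k) c ⟨
      2 * 2 ^ k * c    ∎
      where open ≡-Reasoning

-- If g > 1 and g σ(c) = (g + 1) c, then c = g and σ c = c + 1.  (Write
-- σ c = c + t; then g t = c, so t is a divisor of c, and t ≠ 1 would put
-- 1 + t + c into σ c.)
σ-mersenne-equation : ∀ {g c} → 1 < g → c > 0 → g * σ c ≡ g * c + c → c ≡ g × σ c ≡ c + 1
σ-mersenne-equation {g} {c} 1<g c>0 eq = conclude (t ≟ 1)
  where
  t : ℕ
  t = σ c ∸ c
  σc≡c+t : σ c ≡ c + t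
  σc≡c+t = sym (m+[n∸m]≡n (n≤σn c>0))
  gt≡c : g * t ≡ c
  gt≡c = +-cancelˡ-≡ (g * c) (g * t) c
           (trans (sym (*-distribˡ-+ g c t)) (trans (cong (g *_) (sym σc≡c+t)) eq))
  conclude : Dec (t ≡ 1) → c ≡ g × σ c ≡ c + 1
  conclude (yes t≡1) = trans (sym gt≡c) (trans (cong (g *_) t≡1) (*-identityʳ g))
                     , trans σc≡c+t (cong (c +_) t≡1)
  conclude (no t≢1) = contradiction (≤-trans (σ-nontrivial-divisor 1<t t<c t∣c) (≤-reflexive σc≡c+t′)) (n≮n (t + c))
    where
    σc≡c+t′ : σ c ≡ t + c
    σc≡c+t′ = trans σc≡c+t (+-comm c t)
    t>0 : t > 0
    t>0 = n≢0⇒n>0 (λ t≡0 → <⇒≢ c>0 (trans (sym (*-zeroʳ g)) (trans (cong (g *_) (sym t≡0)) gt≡c)))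
    1<t : 1 < t
    1<t = ≤∧≢⇒< t>0 (λ 1≡t → t≢1 (sym 1≡t))
    t<c : t < c
    t<c = subst (t <_) (trans (*-comm t g) gt≡c) (m<m*n t g {{>-nonZero t>0}} 1<g)
    t∣c : t ∣ c
    t∣c = divides g (sym gt≡c)

evenPerfect : ℕ → ℕ
evenPerfect k = 2 ^ k * geom 2 k

-- Euler: every even perfect number is evenPerfect k with k ≥ 1 and the
-- Mersenne number geom 2 k prime.  Writing N = 2 ^ k c with c odd,
-- σ N = 2N becomes g σ c = (g + 1) c for g = geom 2 k.
even-perfect : ∀ {N} → Perfect N → 2 ∣ N →
  ∃ λ j → N ≡ evenPerfect (suc j) × Prime (geom 2 (suc j))
even-perfect {N} (N>0 , σN≡2N) 2∣N with two-adic N N>0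
... | zero , c , N≡c , 2∤c = contradiction (subst (2 ∣_) (trans N≡c (+-identityʳ c)) 2∣N) 2∤c
... | suc j , c , N≡2^kc , 2∤c =
  j , trans N≡2^kc (cong (2 ^ k *_) c≡g) , σ≡suc⇒prime 1<g (subst (λ x → σ x ≡ x + 1) c≡g σc≡c+1)
  where
  k g : ℕ
  k = suc j
  g = geom 2 k
  1<g : 1 < g
  1<g = s≤s (≤-trans (geom>0 2 j) (m≤m+n (geom 2 j) _))
  c>0 : c > 0
  c>0 = n≢0⇒n>0 (λ { refl → <⇒≢ N>0 (sym (trans N≡2^kc (*-zeroʳ (2 ^ k)))) })
  mersenne-equation : g * σ c ≡ g * c + c
  mersenne-equation = begin
    g * σ c          ≡⟨ σ-prime-power k prime[2] 2∤c c>0 ⟨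
    σ (2 ^ k * c)    ≡⟨ cong σ N≡2^kc ⟨
    σ N              ≡⟨ σN≡2N ⟩
    2 * N            ≡⟨ cong (2 *_) N≡2^kc ⟩
    2 * (2 ^ k * c)  ≡⟨ *-assoc 2 (2 ^ k) c ⟨
    2 ^ suc k * c    ≡⟨ cong (_* c) (geom2+1 k) ⟨
    (g + 1) * c      ≡⟨ *-distribʳ-+ c g 1 ⟩
    g * c + 1 * c    ≡⟨ cong (g * c +_) (*-identityˡ c) ⟩
    g * c + c        ∎
    where open ≡-Reasoning
  c≡g : c ≡ g
  c≡g = proj₁ (σ-mersenne-equation 1<g c>0 mersenne-equation)
  σc≡c+1 : σ c ≡ c + 1
  σc≡c+1 = proj₂ (σ-mersenne-equation 1<g c>0 mersenne-equation)

cofactor : ℕ → ℕ → ℕ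
cofactor N zero    = 0
cofactor N (suc e) = N / suc e

cofactor-eq : ∀ {N e} → e ∣ N → e > 0 → e * cofactor N e ≡ N
cofactor-eq {N} {suc e} e∣N _ = m*[n/m]≡n e∣N

map-unique-on : ∀ {f : ℕ → ℕ} {xs} → Unique xs →
  (∀ {x y} → x ∈ xs → y ∈ xs → f x ≡ f y → x ≡ y) → Unique (map f xs)
map-unique-on {f} {[]}     []               _   = []
map-unique-on {f} {x ∷ xs} (x∉xs ∷ uxs) inj =
  All.tabulate fx∉ ∷ map-unique-on uxs (λ x∈ y∈ → inj (there x∈) (there y∈))
  where
  fx∉ : ∀ {y} → y ∈ map f xs → f x ≢ y
  fx∉ y∈ fx≡fz with ∈-map⁻ f {xs = xs} y∈
  ... | z , z∈ , refl = All.lookup x∉xs z∈ (inj (here refl) (there z∈) fx≡fz)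

∣-sum-pairs : ∀ q (h : ℕ → ℕ) xs → (∀ {x} → x ∈ xs → q ∣ x + h x) → q ∣ sum xs + sum (map h xs)
∣-sum-pairs q h []       _    = q ∣0
∣-sum-pairs q h (x ∷ xs) q∣x+hx = subst (q ∣_) (regroup x (sum xs) (h x) (sum (map h xs)))
  (∣m∣n⇒∣m+n (q∣x+hx (here refl)) (∣-sum-pairs q h xs (λ x∈ → q∣x+hx (there x∈))))
  where
  regroup : ∀ a b c d → (a + c) + (b + d) ≡ (a + b) + (c + d)
  regroup = solve-∀

factor>0 : ∀ {N} e {f} → N > 0 → e * f ≡ N → f > 0
factor>0 e {f} N>0 ef≡N = n≢0⇒n>0 (λ { refl → <⇒≢ N>0 (sym (trans (sym ef≡N) (*-zeroʳ e))) })

_²<?_ : ∀ e N → Dec (e * e < N)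
e ²<? N = e * e <? N

small-divisors : ℕ → List ℕ
small-divisors N = filter (_²<? N) (divisors N)

∈-small⁻ : ∀ {N e} → e ∈ small-divisors N → e * cofactor N e ≡ N × e * e < N
∈-small⁻ {N} e∈ with ∈-filter⁻ (_²<? N) {xs = divisors N} e∈
... | e∈divisors , e²<N with ∈-divisors⁻ {N} e∈divisors
...   | e∣N , e>0 = cofactor-eq e∣N e>0 , e²<N

cofactor-injective : ∀ {N x y} → N > 0 → x ∈ small-divisors N → y ∈ small-divisors N →
  cofactor N x ≡ cofactor N y → x ≡ y
cofactor-injective {N} {x} {y} N>0 x∈ y∈ same = *-cancelʳ-≡ x y (cofactor N y)
  {{>-nonZero (factor>0 y N>0 (proj₁ (∈-small⁻ y∈)))}}
  (trans (cong (x *_) (sym same)) (trans (proj₁ (∈-small⁻ x∈)) (sym (proj₁ (∈-small⁻ y∈)))))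

-- The partner of a small divisor exceeds it, so it is not itself small.
partner-not-small : ∀ {N e} → e ∈ small-divisors N → cofactor N e ∉ small-divisors N
partner-not-small {N} {e} e∈ f∈ = <-asym e<f f<e
  where
  f : ℕ
  f = cofactor N e
  ef≡N : e * f ≡ N
  ef≡N = proj₁ (∈-small⁻ e∈)
  e<f : e < f
  e<f = *-cancelˡ-< e e f (subst (e * e <_) (sym ef≡N) (proj₂ (∈-small⁻ e∈)))
  f<e : f < e
  f<e = *-cancelʳ-< f f e (subst (f * f <_) (sym ef≡N) (proj₂ (∈-small⁻ f∈)))

-- Every divisor x of a non-square N with x² ≥ N is the partner of the small
-- divisor N / x.
large-is-partner : ∀ {N x} → N > 0 → (∀ e → e * e ≢ N) → x ∈ divisors N → ¬ x * x < N →
  x ∈ map (cofactor N) (small-divisors N)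
large-is-partner {N} {x} N>0 nonsquare x∈ x²≮N =
  subst (_∈ map (cofactor N) (small-divisors N)) partner-of-y (∈-map⁺ (cofactor N) y∈small)
  where
  xy≡N : x * cofactor N x ≡ N
  xy≡N = cofactor-eq (proj₁ (∈-divisors⁻ {N} x∈)) (proj₂ (∈-divisors⁻ {N} x∈))
  y : ℕ
  y = cofactor N x
  instance y≢0 : NonZero y
  y≢0 = >-nonZero (factor>0 x N>0 xy≡N)
  y<x : y < x
  y<x = *-cancelˡ-< x y x (subst (_< x * x) (sym xy≡N)
          (≤∧≢⇒< (≮⇒≥ x²≮N) (λ N≡x² → nonsquare x (sym N≡x²))))
  y∣N : y ∣ N
  y∣N = divides x (sym xy≡N)
  y∈small : y ∈ small-divisors N
  y∈small = ∈-filter⁺ (_²<? N) (∈-divisors⁺ N>0 y∣N)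
    (subst (y * y <_) (trans (*-comm y x) xy≡N) (*-monoʳ-< y y<x))
  partner-of-y : cofactor N y ≡ x
  partner-of-y = *-cancelˡ-≡ (cofactor N y) x y
    (trans (cofactor-eq y∣N (>-nonZero⁻¹ y)) (trans (sym xy≡N) (*-comm x y)))

σ-small+partners : ∀ {N} → N > 0 → (∀ e → e * e ≢ N) →
  σ N ≡ sum (small-divisors N) + sum (map (cofactor N) (small-divisors N))
σ-small+partners {N} N>0 nonsquare = trans
  (sum-cong-∈ (divisors-unique N) (Unique.++⁺ unique-small unique-large disjoint) to from)
  (sum-++ small large)
  where
  small large : List ℕ
  small = small-divisors N
  large = map (cofactor N) small
  unique-small : Unique small
  unique-small = Unique.filter⁺ (_²<? N) (divisors-unique N)
  unique-large : Unique large
  unique-large = map-unique-on unique-small (cofactor-injective N>0)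
  disjoint : ∀ {v} → ¬ (v ∈ small × v ∈ large)
  disjoint (v∈small , v∈large) with ∈-map⁻ (cofactor N) {xs = small} v∈large
  ... | e , e∈ , refl = partner-not-small e∈ v∈small
  to : ∀ {x} → x ∈ divisors N → x ∈ small ++ large
  to {x} x∈ with x ²<? N
  ... | yes x²<N = ∈-++⁺ˡ (∈-filter⁺ (_²<? N) x∈ x²<N)
  ... | no x²≮N  = ∈-++⁺ʳ small (large-is-partner N>0 nonsquare x∈ x²≮N)
  from : ∀ {x} → x ∈ small ++ large → x ∈ divisors N
  from x∈ with ∈-++⁻ small x∈
  ... | inj₁ x∈small = proj₁ (∈-filter⁻ (_²<? N) {xs = divisors N} x∈small)
  ... | inj₂ x∈large with ∈-map⁻ (cofactor N) {xs = small} x∈large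
  ... | e , e∈ , refl = ∈-divisors⁺ N>0 (divides e (sym (proj₁ (∈-small⁻ e∈))))

σ-pairing : ∀ {N q} → N > 0 → (∀ e f → e * f ≡ N → q ∣ e + f) → (∀ e → e * e ≢ N) → q ∣ σ N
σ-pairing {N} {q} N>0 q∣e+f nonsquare = subst (q ∣_) (sym (σ-small+partners N>0 nonsquare))
  (∣-sum-pairs q (cofactor N) (small-divisors N) (λ {e} e∈ → q∣e+f e (cofactor N e) (proj₁ (∈-small⁻ e∈))))

SumsVanish : (q r : ℕ) .{{_ : NonZero q}} → Set
SumsVanish q r = ∀ {a} → a < q → ∀ {b} → b < q → (a * b) % q ≡ r → (a + b) % q ≡ 0

sumsVanish? : (q r : ℕ) .{{_ : NonZero q}} → Dec (SumsVanish q r)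
sumsVanish? q r = allUpTo? (λ a → allUpTo? (λ b → ((a * b) % q ≟ r) →-dec ((a + b) % q ≟ 0)) q) q

NonSquare : (q r : ℕ) .{{_ : NonZero q}} → Set
NonSquare q r = ∀ {a} → a < q → (a * a) % q ≢ r

nonSquare? : (q r : ℕ) .{{_ : NonZero q}} → Dec (NonSquare q r)
nonSquare? q r = allUpTo? (λ a → ¬? ((a * a) % q ≟ r)) q

-- If the residue r mod q has both properties, a perfect N ≡ r (mod q) would
-- have q ∣ σ N = N + N by σ-pairing, so r + r ≡ 0 (mod q).
perfect-residue : ∀ {N q r} .{{_ : NonZero q}} → SumsVanish q r → NonSquare q r →
  Perfect N → N % q ≡ r → (r + r) % q ≡ 0
perfect-residue {N} {q} {r} sums nonsquare (N>0 , σN≡2N) N%q≡r = begin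
    (r + r) % q              ≡⟨ cong (λ x → (x + x) % q) N%q≡r ⟨
    (N % q + N % q) % q      ≡⟨ %-distribˡ-+ N N q ⟨
    (N + N) % q              ≡⟨ cong (_% q) (cong (N +_) (+-identityʳ N)) ⟨
    (2 * N) % q              ≡⟨ n∣m⇒m%n≡0 (2 * N) q (subst (q ∣_) σN≡2N q∣σN) ⟩
    0                        ∎
  where
  open ≡-Reasoning
  residues : ∀ {e f} → e * f ≡ N → (e % q) * (f % q) % q ≡ r
  residues {e} {f} ef≡N = trans (sym (%-distribˡ-* e f q)) (trans (cong (_% q) ef≡N) N%q≡r)
  q∣σN : q ∣ σ N
  q∣σN = σ-pairing N>0
    (λ e f ef≡N → m%n≡0⇒n∣m (e + f) q (trans (%-distribˡ-+ e f q)
                    (sums (m%n<n e q) (m%n<n f q) (residues ef≡N))))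
    (λ e e²≡N → nonsquare (m%n<n e q) (residues e²≡N))

perfect-≢2-mod-3 : ∀ {N} → Perfect N → N % 3 ≢ 2
perfect-≢2-mod-3 perfN N%3≡2 with perfect-residue
  (toWitness {a? = sumsVanish? 3 2} tt) (toWitness {a? = nonSquare? 3 2} tt) perfN N%3≡2
... | ()

perfect-≢3-mod-4 : ∀ {N} → Perfect N → N % 4 ≢ 3
perfect-≢3-mod-4 perfN N%4≡3 with perfect-residue
  (toWitness {a? = sumsVanish? 4 3} tt) (toWitness {a? = nonSquare? 4 3} tt) perfN N%4≡3
... | ()

odd-if-succ-even : ∀ {a} → 2 ∣ a + 1 → 2 ∤ a
odd-if-succ-even {a} 2∣a+1 2∣a with () ← ∣1⇒≡1 (∣m+n∣m⇒∣n 2∣a+1 2∣a)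

odd% : ∀ {a} → 2 ∤ a → a % 2 ≡ 1
odd% {a} 2∤a with a % 2 | m%n<n a 2 | m%n≡0⇒n∣m a 2
... | 0 | _ | 2∣a = contradiction (2∣a refl) 2∤a
... | 1 | _ | _ = refl
... | suc (suc _) | s≤s (s≤s ()) | _

odd+odd : ∀ {a b} → 2 ∤ a → 2 ∤ b → 2 ∣ a + b
odd+odd {a} {b} 2∤a 2∤b = m%n≡0⇒n∣m (a + b) 2
  (trans (%-distribˡ-+ a b 2) (cong₂ (λ u v → (u + v) % 2) (odd% 2∤a) (odd% 2∤b)))

geom2-step : ∀ k → geom 2 (2 + k) ≡ geom 2 k + (1 + geom 2 k) * 3
geom2-step k = identity (geom 2 k)
  where
  identity : ∀ x → 1 + 2 * (1 + 2 * x) ≡ x + (1 + x) * 3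
  identity = solve-∀

pow2-step : ∀ k → 2 ^ (2 + k) ≡ 2 ^ k + 2 ^ k * 3
pow2-step k = identity (2 ^ k)
  where
  identity : ∀ y → 2 * (2 * y) ≡ y + y * 3
  identity = solve-∀

mersenne-mod-3 : ∀ k → 3 ∣ geom 2 k ⊎ (2 ^ k % 3 ≡ 1 × geom 2 k % 3 ≡ 1)
mersenne-mod-3 zero          = inj₂ (refl , refl)
mersenne-mod-3 (suc zero)    = inj₁ ∣-refl
mersenne-mod-3 (suc (suc k)) with mersenne-mod-3 k
... | inj₁ 3∣g = inj₁ (subst (3 ∣_) (sym (geom2-step k)) (∣m∣n⇒∣m+n 3∣g (n∣m*n (1 + geom 2 k))))
... | inj₂ (2^k%3≡1 , g%3≡1) =
  inj₂ ( trans (cong (_% 3) (pow2-step k)) (trans ([m+kn]%n≡m%n (2 ^ k) (2 ^ k) 3) 2^k%3≡1)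
       , trans (cong (_% 3) (geom2-step k)) (trans ([m+kn]%n≡m%n (geom 2 k) (1 + geom 2 k) 3) g%3≡1))

evenPerfect-doubling : ∀ k → 2 * evenPerfect k < evenPerfect (suc k)
evenPerfect-doubling k = subst (2 * evenPerfect k <_) (sym (expand (2 ^ k) (geom 2 k)))
  (m<m+n (2 * evenPerfect k) (≤-trans (m^n>0 2 k) (≤-trans (m≤m+n (2 ^ k) (2 ^ k + 0)) (m≤m+n (2 * 2 ^ k) _))))
  where
  expand : ∀ a g → (2 * a) * (1 + 2 * g) ≡ 2 * (a * g) + (2 * a + 2 * (a * g))
  expand = solve-∀

evenPerfect-growth : ∀ {i j} → i < j → 2 * evenPerfect i < evenPerfect j
evenPerfect-growth {i} {suc j} (s≤s i≤j) with m≤n⇒m<n∨m≡n i≤j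
... | inj₂ refl = evenPerfect-doubling i
... | inj₁ i<j  = <-trans (evenPerfect-growth i<j) (≤-<-trans (m≤m+n _ _) (evenPerfect-doubling j))

evenPerfect-sparse : ∀ i j → evenPerfect i < evenPerfect j → 2 * evenPerfect i < evenPerfect j
evenPerfect-sparse i j Pi<Pj with <-cmp i j
... | tri< i<j _ _ = evenPerfect-growth i<j
... | tri≈ _ refl _ = contradiction Pi<Pj (<-irrefl refl)
... | tri> _ _ j<i = contradiction (<-trans Pi<Pj (≤-<-trans (m≤m+n _ _) (evenPerfect-growth j<i))) (<-irrefl refl)

-- Both even: x < x + d ≤ 2x contradicts the sparsity of even perfect numbers.
both-even : ∀ {x d} → Perfect x → Perfect (x + d) → 2 ∣ x → 2 ∣ x + d → d > 0 → d ≤ x → ⊥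
both-even {x} {d} perfx perfy 2∣x 2∣y d>0 d≤x with even-perfect perfx 2∣x | even-perfect perfy 2∣y
... | i , x≡Pi , _ | j , y≡Pj , _ = <-irrefl refl (begin-strict
    2 * x    <⟨ subst₂ (λ a b → 2 * a < b) (sym x≡Pi) (sym y≡Pj) (evenPerfect-sparse (suc i) (suc j) Pi<Pj) ⟩
    x + d    ≤⟨ +-monoʳ-≤ x d≤x ⟩
    x + x    ≡⟨ cong (x +_) (+-identityʳ x) ⟨
    2 * x    ∎)
  where
  open ≤-Reasoning
  Pi<Pj : evenPerfect (suc i) < evenPerfect (suc j)
  Pi<Pj = subst₂ _<_ x≡Pi y≡Pj (m<m+n x d>0)

-- For an odd c and a prime g = 2c + 1, the product c g is not perfect:
-- σ (c g) = (g + 1) σ c = 2 (c + 1) σ c, so σ (c g) = 2 c g would give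
-- (c + 1) σ c = c g with c + 1 even but c and g odd.
below-mersenne-not-perfect : ∀ {c g} → Prime g → g ≡ 2 * c + 1 → 2 ∤ c → ¬ Perfect (c * g)
below-mersenne-not-perfect {c} {g} pg g≡2c+1 2∤c (cg>0 , σcg≡2cg) =
  [ 2∤c , 2∤g ]′ (euclidsLemma c g prime[2] 2∣cg)
  where
  instance g≢0 : NonZero g
  g≢0 = prime⇒nonZero pg
  2∤g : 2 ∤ g
  2∤g 2∣g with () ← ∣1⇒≡1 (∣m+n∣m⇒∣n (subst (2 ∣_) g≡2c+1 2∣g) (m∣m*n c))
  c>0 : c > 0
  c>0 = n≢0⇒n>0 (λ { refl → <-irrefl refl cg>0 })
  g∤c : g ∤ c
  g∤c g∣c = <⇒≱ (subst (c <_) (sym g≡2c+1) (≤-<-trans (m≤m+n c (c + 0)) (m<m+n (2 * c) z<s)))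
                 (∣⇒≤ {{>-nonZero c>0}} g∣c)
  σcg≡2[c+1]σc : σ (c * g) ≡ 2 * ((c + 1) * σ c)
  σcg≡2[c+1]σc = begin
    σ (c * g)                ≡⟨ cong σ (trans (*-comm c g) (cong (_* c) (sym (*-identityʳ g)))) ⟩
    σ (g ^ 1 * c)            ≡⟨ σ-prime-power 1 pg g∤c c>0 ⟩
    (1 + g * 1) * σ c        ≡⟨ cong (λ x → (1 + x) * σ c) (trans (*-identityʳ g) g≡2c+1) ⟩
    (1 + (2 * c + 1)) * σ c  ≡⟨ regroup c (σ c) ⟩
    2 * ((c + 1) * σ c)      ∎
    where
    open ≡-Reasoning
    regroup : ∀ c s → (1 + (2 * c + 1)) * s ≡ 2 * ((c + 1) * s)
    regroup = solve-∀
  2∣c+1 : 2 ∣ c + 1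
  2∣c+1 = odd+odd 2∤c (λ 2∣1 → contradiction (∣1⇒≡1 2∣1) λ ())
  2∣cg : 2 ∣ c * g
  2∣cg = subst (2 ∣_) (*-cancelˡ-≡ _ _ 2 (trans (sym σcg≡2[c+1]σc) σcg≡2cg))
                      (∣-trans 2∣c+1 (m∣m*n (σ c)))

7≤mersenne : ∀ i → 7 ≤ geom 2 (2 + i)
7≤mersenne i = s≤s (*-monoʳ-≤ 2 (s≤s (*-monoʳ-≤ 2 (geom>0 2 i))))

-- If the Mersenne number g = geom 2 k (k ≥ 2) is prime, then 2 ^ k ≡ g ≡ 1
-- (mod 3), since the other alternative of mersenne-mod-3 makes g = 3.
prime-mersenne-mod-3 : ∀ i → Prime (geom 2 (2 + i)) → 2 ^ (2 + i) % 3 ≡ 1 × geom 2 (2 + i) % 3 ≡ 1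
prime-mersenne-mod-3 i pg with mersenne-mod-3 (2 + i)
... | inj₂ residues = residues
... | inj₁ 3∣g with prime⇒irreducible pg 3∣g
...   | inj₂ 3≡g = contradiction (subst (7 ≤_) (sym 3≡g) (7≤mersenne i)) λ { (s≤s (s≤s (s≤s ()))) }

-- O = E + d ≡ 1 + 1 (mod 3); O = E − 1 ≡ 3
-- (mod 4); O = E − g = (2 ^ k − 1) g falls under below-mersenne-not-perfect.
mixed-large : ∀ i {O d} → Prime (geom 2 (2 + i)) → Perfect O → d ∣ O →
  d ≡ 1 ⊎ d ≡ geom 2 (2 + i) → O ≡ evenPerfect (2 + i) + d ⊎ evenPerfect (2 + i) ≡ O + d → ⊥
mixed-large i {O} {d} pg perfO _ d≡1∨g (inj₁ O≡E+d) =
  perfect-≢2-mod-3 perfO (trans (cong (_% 3) O≡E+d)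
    (trans (%-distribˡ-+ E d 3) (cong₂ (λ u v → (u + v) % 3) E%3≡1 (d%3≡1 d≡1∨g))))
  where
  k g E : ℕ
  k = 2 + i
  g = geom 2 k
  E = evenPerfect k
  residues : 2 ^ k % 3 ≡ 1 × g % 3 ≡ 1
  residues = prime-mersenne-mod-3 i pg
  E%3≡1 : E % 3 ≡ 1
  E%3≡1 = trans (%-distribˡ-* (2 ^ k) g 3) (cong₂ (λ u v → (u * v) % 3) (proj₁ residues) (proj₂ residues))
  d%3≡1 : d ≡ 1 ⊎ d ≡ g → d % 3 ≡ 1
  d%3≡1 (inj₁ refl) = refl
  d%3≡1 (inj₂ refl) = proj₂ residues
mixed-large i {O} pg perfO _ (inj₁ refl) (inj₂ E≡O+1) =
  perfect-≢3-mod-4 perfO (%-pred-≡0 {O} (trans (cong (_% 4) (trans (+-comm 1 O) (sym E≡O+1)))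
                                          (n∣m⇒m%n≡0 _ 4 4∣E)))
  where
  4∣E : 4 ∣ evenPerfect (2 + i)
  4∣E = ∣-trans (divides (2 ^ i) (trans (sym (*-assoc 2 2 (2 ^ i))) (*-comm 4 (2 ^ i)))) (m∣m*n (geom 2 (2 + i)))
mixed-large i {O} pg perfO (divides q O≡qg) (inj₂ refl) (inj₂ E≡O+g) =
  below-mersenne-not-perfect pg g≡2q+1 2∤q (subst Perfect O≡qg perfO)
  where
  k g : ℕ
  k = 2 + i
  g = geom 2 k
  instance g≢0 : NonZero g
  g≢0 = prime⇒nonZero pg
  q+1≡2^k : q + 1 ≡ 2 ^ k
  q+1≡2^k = *-cancelʳ-≡ (q + 1) (2 ^ k) g (begin
    (q + 1) * g   ≡⟨ *-distribʳ-+ g q 1 ⟩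
    q * g + 1 * g ≡⟨ cong (q * g +_) (*-identityˡ g) ⟩
    q * g + g     ≡⟨ cong (_+ g) O≡qg ⟨
    O + g         ≡⟨ E≡O+g ⟨
    2 ^ k * g     ∎)
    where open ≡-Reasoning
  g≡2q+1 : g ≡ 2 * q + 1
  g≡2q+1 = +-cancelʳ-≡ 1 g (2 * q + 1) (begin
    g + 1          ≡⟨ geom2+1 k ⟩
    2 * 2 ^ k      ≡⟨ cong (2 *_) q+1≡2^k ⟨
    2 * (q + 1)    ≡⟨ *-distribˡ-+ 2 q 1 ⟩
    2 * q + 2      ≡⟨ +-assoc (2 * q) 1 1 ⟨
    2 * q + 1 + 1  ∎)
    where open ≡-Reasoning
  2∤q : 2 ∤ q
  2∤q = odd-if-succ-even (subst (2 ∣_) (sym q+1≡2^k) (m∣m*n (2 ^ suc i)))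

-- For k = 1 (E = 6) the candidates
-- O = 7, 9, 5, 3 are checked directly; k ≥ 2 is mixed-large.
mixed-even-perfect : ∀ j {O d} → Prime (geom 2 (suc j)) → Perfect O → d ∣ O →
  d ≡ 1 ⊎ d ≡ geom 2 (suc j) → O ≡ evenPerfect (suc j) + d ⊎ evenPerfect (suc j) ≡ O + d → ⊥
mixed-even-perfect zero     _ perfO _ (inj₁ refl) (inj₁ refl) = contradiction perfO λ { (_ , ()) }
mixed-even-perfect zero     _ perfO _ (inj₂ refl) (inj₁ refl) = contradiction perfO λ { (_ , ()) }
mixed-even-perfect zero {O} _ perfO _ (inj₁ refl) (inj₂ 6≡O+1) =
  contradiction (subst Perfect (+-cancelʳ-≡ 1 O 5 (sym 6≡O+1)) perfO) λ { (_ , ()) }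
mixed-even-perfect zero {O} _ perfO _ (inj₂ refl) (inj₂ 6≡O+3) =
  contradiction (subst Perfect (+-cancelʳ-≡ 3 O 3 (sym 6≡O+3)) perfO) λ { (_ , ()) }
mixed-even-perfect (suc i) = mixed-large i

-- Mixed parities: d divides the odd O, so it is odd and, dividing E = 2 ^ k g,
-- it divides the Mersenne prime g.
mixed : ∀ {E O d} → Perfect E → Perfect O → 2 ∣ E → 2 ∤ O → d ∣ E → d ∣ O →
  O ≡ E + d ⊎ E ≡ O + d → ⊥
mixed {E} {O} {d} perfE perfO 2∣E 2∤O d∣E d∣O gap with even-perfect perfE 2∣E
... | j , refl , pg = mixed-even-perfect j pg perfO d∣O (prime⇒irreducible pg d∣g) gap
  where
  d∣g : d ∣ geom 2 (suc j)
  d∣g = coprime-∣-pow* (suc j) (prime∤⇒coprime prime[2] (λ 2∣d → 2∤O (∣-trans 2∣d d∣O))) d∣E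

-- Both odd: d divides the odd x, so d is odd and x + d is even.
both-odd : ∀ {x d} → 2 ∤ x → 2 ∤ x + d → d ∣ x → ⊥
both-odd 2∤x 2∤x+d d∣x = 2∤x+d (odd+odd 2∤x (λ 2∣d → 2∤x (∣-trans 2∣d d∣x)))

no-perfect-gap : ∀ {x d} → Perfect x → Perfect (x + d) → d > 0 → d ∣ x → ⊥
no-perfect-gap {x} {d} perfx perfy d>0 d∣x with 2 ∣? x | 2 ∣? (x + d)
... | yes 2∣x | yes 2∣y = both-even perfx perfy 2∣x 2∣y d>0 (∣⇒≤ {{>-nonZero (proj₁ perfx)}} d∣x)
... | yes 2∣x | no 2∤y  = mixed perfx perfy 2∣x 2∤y d∣x (∣m∣n⇒∣m+n d∣x ∣-refl) (inj₁ refl)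
... | no 2∤x  | yes 2∣y = mixed perfy perfx 2∣y 2∤x (∣m∣n⇒∣m+n d∣x ∣-refl) d∣x (inj₂ refl)
... | no 2∤x  | no 2∤y  = both-odd 2∤x 2∤y d∣x

ordered-gap : ∀ {a b} → Perfect a → Perfect b → a < b → ¬ (b ∸ a ∣ a)
ordered-gap {a} {b} perfa perfb a<b =
  no-perfect-gap perfa (subst Perfect (sym (m+[n∸m]≡n (<⇒≤ a<b))) perfb) (m<n⇒0<n∸m a<b)

gap∣larger⇒gap∣smaller : ∀ {a b} → a ≤ b → b ∸ a ∣ b → b ∸ a ∣ a
gap∣larger⇒gap∣smaller {a} {b} a≤b δ∣b =
  ∣m+n∣m⇒∣n (subst (b ∸ a ∣_) (trans (sym (m+[n∸m]≡n a≤b)) (+-comm a (b ∸ a))) δ∣b) ∣-refl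

proposition2p4 : (n m : ℕ) → Perfect n → Perfect m → n ≢ m → ¬ (∣ n - m ∣ ∣ n)
proposition2p4 n m perfn perfm n≢m δ∣n with <-cmp n m
... | tri≈ _ n≡m _ = n≢m n≡m
... | tri< n<m _ _ = ordered-gap perfn perfm n<m (subst (_∣ n) (m≤n⇒∣m-n∣≡n∸m (<⇒≤ n<m)) δ∣n)
... | tri> _ _ m<n = ordered-gap perfm perfn m<n
      (gap∣larger⇒gap∣smaller (<⇒≤ m<n) (subst (_∣ n) (m≤n⇒∣n-m∣≡n∸m (<⇒≤ m<n)) δ∣n))
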